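{- Fix an integer $n$ and let $C_t$, $t\in\mathbb{Q}\cap[0,1]$, be defined by $C_{0/1}=A(n)_q$, $C_{1/1}=B(n)_q$, and $C_{\frac{r+r'}{s+s'}}=C_{r/s}\,C_{r'/s'}$ for every pair of Farey neighbours $\frac rs<\frac{r'}{s'}$ in $[0,1]$. Then for every $t$, writing $C_t=\begin{pmatrix}c_{11}&c_{12}\\c_{21}&c_{22}\end{pmatrix}$, $$\frac{\mathrm{Tr}(C_t)}{q^{ -1}[3]_q}=(q^{ -1}-q^{ -2})\,c_{11}+q^{ -1}c_{12}=q^2c_{12}+q(1-q)\,c_{22}.$$
   Context: Let $q$ be a formal variable, $[k]_q=\frac{q^k-1}{q-1}$ for $k\in\mathbb{Z}$ (so $[3]_q=q^2+q+1$). For $n\in\mathbb{Z}$ let $$A(n)_q=\begin{pmatrix} q^{2-n}[n]_q & q^{1-n}\\ [n]_q[3-n]_q-q^{n-1} & q^{ -1}[3-n]_q\end{pmatrix},\qquad B(n)_q=A(n)_q\,A(n+1)_q .$$ Two rationals $\frac{r}{s}<\frac{r'}{s'}$ in $[0,1]$, written in lowest terms with $s,s'>0$, are Farey neighbours if $r's-rs'=1$; every rational in $(0,1)$ is the mediant $\frac{r+r'}{s+s'}$ of exactly one pair of Farey neighbours in $[0,1]$. -}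

module Defs where

open import Algebra.Bundles using (CommutativeRing)
open import Data.Nat using (ℕ; zero; suc)
open import Data.Integer using (ℤ; +_; -[1+_])
import Data.Integer as ℤ
open import Data.Product using (_×_)
open import Level using (_⊔_)

record M2 {c ℓ} (R : CommutativeRing c ℓ) : Set c where
  constructor mat
  field
    m11 m12 m21 m22 : CommutativeRing.Carrier R

-- Everything in the formal variable q is interpreted in an arbitrary
-- commutative ring R with a unit q (inverse q⁻); ℤ[q,q⁻¹] is the
-- universal such ring.
module QDefs {c ℓ} (R : CommutativeRing c ℓ) (q q⁻ : CommutativeRing.Carrier R) where
  open CommutativeRing R
  open M2

  pow : Carrier → ℕ → Carrier
  pow x zero = 1#
  pow x (suc k) = x * pow x k

  qpow : ℤ → Carrier
  qpow (+ k) = pow q k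
  qpow -[1+ k ] = pow q⁻ (suc k)

  geom : ℕ → Carrier
  geom zero = 0#
  geom (suc k) = 1# + q * geom k

  negGeom : ℕ → Carrier
  negGeom zero = 0#
  negGeom (suc k) = q⁻ * (1# + negGeom k)

  -- [k]_q = (q^k - 1)/(q - 1) for k ∈ ℤ
  qint : ℤ → Carrier
  qint (+ k) = geom k
  qint -[1+ k ] = - negGeom (suc k)

  _·_ : M2 R → M2 R → M2 R
  X · Y = mat (m11 X * m11 Y + m12 X * m21 Y) (m11 X * m12 Y + m12 X * m22 Y)
              (m21 X * m11 Y + m22 X * m21 Y) (m21 X * m12 Y + m22 X * m22 Y)

  _≈M_ : M2 R → M2 R → Set ℓ
  X ≈M Y = (m11 X ≈ m11 Y) × (m12 X ≈ m12 Y) × (m21 X ≈ m21 Y) × (m22 X ≈ m22 Y)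

  tr : M2 R → Carrier
  tr X = m11 X + m22 X

  A : ℤ → M2 R
  A n = mat (qpow (+ 2 ℤ.- n) * qint n) (qpow (+ 1 ℤ.- n))
            (qint n * qint (+ 3 ℤ.- n) - qpow (n ℤ.- + 1)) (q⁻ * qint (+ 3 ℤ.- n))

  B : ℤ → M2 R
  B n = A n · A (n ℤ.+ + 1)

-- Write ψ X = x₁₁ + q³ x₂₂ − q [3] x₁₂. Since q is a unit, both trace formulas follow from
-- ψ (C t) = 0, and ψ is linear. For 2 × 2 matrices Cayley–Hamilton gives
-- X (X Y) = tr X · X Y − det X · Y and (X Y) Y = tr Y · X Y − det Y · X; hence if ψ vanishes on
-- C a, C b and C a · C b for consecutive fractions a < b of the Stern–Brocot construction of
-- [0, 1], it vanishes on the corresponding triples for (a, a ⊕ b) and (a ⊕ b, b). For the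
-- initial pair (0, 1) this is a computation with q-integers: A m has determinant 1 and, apart
-- from its lower-left entry, is a polynomial in q and [1 − m]_q. Every Farey pair in [0, 1] is
-- reached from (0, 1) by descending along the larger denominator, and every rational in [0, 1]
-- belongs to a Farey pair by Bézout's identity.
module Submission where

open import Defs
open import Algebra.Bundles using (CommutativeRing)
open import Data.Integer using (ℤ; +_)
import Data.Integer as ℤ
open import Data.Rational using (ℚ; ↥_; ↧_; 0ℚ; 1ℚ; _≤_)
open import Data.Product using (_×_)
open import Relation.Binary.PropositionalEquality using (_≡_)

open import Data.Integer using (-[1+_])
import Data.Integer.Properties as ℤ
open import Data.Integer.Tactic.RingSolver using (solve-∀)
open import Data.Nat as ℕ using (ℕ; zero; suc; z≤n; s≤s)
import Data.Nat.Properties as ℕ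
open import Data.Product using (∃; ∃₂; _,_; proj₁; proj₂)
open import Data.Rational using (mkℚ; *≤*)
open import Data.Sum using (_⊎_; inj₁; inj₂)
import Relation.Binary.PropositionalEquality as ≡

-- The standard library's ring solver for an arbitrary commutative ring, with integer
-- coefficients represented as pairs (m , n) standing for m − n. Coefficient arithmetic keeps
-- the pairs canonical (one component zero), so normal forms are unique and identities are
-- discharged by `solve … refl`.
module RingSolver {c ℓ} (R : CommutativeRing c ℓ) where
  open import Algebra.Bundles using (RawRing)
  open import Algebra.Solver.Ring.AlmostCommutativeRing using (fromCommutativeRing; _-Raw-AlmostCommutative⟶_)
  open import Data.Maybe using (Maybe; just; nothing)
  open import Level using (0ℓ)
  open import Relation.Nullary using (yes; no)
  open CommutativeRing R
  open import Algebra.Properties.Ring ring using (x[y-z]≈xy-xz; [y-z]x≈yx-zx)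
  open import Algebra.Properties.AbelianGroup +-abelianGroup
    using (⁻¹-∙-comm; ⁻¹-anti-homo‿-; ε⁻¹≈ε; x∙y⁻¹≈ε⇒x≈y)
  open import Algebra.Properties.CommutativeSemigroup +-commutativeSemigroup using (interchange)
  open import Algebra.Properties.Semiring.Mult.TCOptimised semiring
    using (×-homo-+; ×1-homo-*) renaming (_×_ to _×ᵣ_)
  open import Relation.Binary.Reasoning.Setoid setoid

  private
    canonical : ℕ × ℕ → ℕ × ℕ
    canonical (suc m , suc n) = canonical (m , n)
    canonical mn              = mn

    Differences : RawRing 0ℓ 0ℓ
    Differences = record
      { Carrier = ℕ × ℕ
      ; _≈_     = _≡_
      ; _+_     = λ (m , n) (m′ , n′) → canonical (m ℕ.+ m′ , n ℕ.+ n′)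
      ; _*_     = λ (m , n) (m′ , n′) → canonical (m ℕ.* m′ ℕ.+ n ℕ.* n′ , m ℕ.* n′ ℕ.+ n ℕ.* m′)
      ; -_      = λ (m , n) → (n , m)
      ; 0#      = (0 , 0)
      ; 1#      = (1 , 0)
      }

    ⟦_⟧ᴰ : ℕ × ℕ → Carrier
    ⟦ m , zero  ⟧ᴰ = m ×ᵣ 1#
    ⟦ m , suc n ⟧ᴰ = m ×ᵣ 1# - suc n ×ᵣ 1#

    ⟦⟧ᴰ≈ : ∀ m n → ⟦ m , n ⟧ᴰ ≈ m ×ᵣ 1# - n ×ᵣ 1#
    ⟦⟧ᴰ≈ m zero    = sym (trans (+-congˡ ε⁻¹≈ε) (+-identityʳ _))
    ⟦⟧ᴰ≈ m (suc n) = refl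

    difference-product : ∀ a b a′ b′ → (a * a′ + b * b′) - (a * b′ + b * a′) ≈ (a - b) * (a′ - b′)
    difference-product a b a′ b′ = begin
      (a * a′ + b * b′) - (a * b′ + b * a′)       ≈⟨ +-congˡ (⁻¹-∙-comm _ _) ⟨
      (a * a′ + b * b′) + (- (a * b′) - b * a′)   ≈⟨ interchange _ _ _ _ ⟩
      (a * a′ - a * b′) + (b * b′ - b * a′)       ≈⟨ +-congˡ (⁻¹-anti-homo‿- _ _) ⟨
      (a * a′ - a * b′) - (b * a′ - b * b′)       ≈⟨ +-cong (x[y-z]≈xy-xz a a′ b′) (-‿cong (x[y-z]≈xy-xz b a′ b′)) ⟨
      a * (a′ - b′) - b * (a′ - b′)               ≈⟨ [y-z]x≈yx-zx _ a b ⟨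
      (a - b) * (a′ - b′)                         ∎

    difference-cong : ∀ a b a′ b′ → a + b′ ≈ a′ + b → a - b ≈ a′ - b′
    difference-cong a b a′ b′ a+b′≈a′+b = x∙y⁻¹≈ε⇒x≈y _ _ (begin
      (a - b) - (a′ - b′)      ≈⟨ +-congˡ (⁻¹-anti-homo‿- _ _) ⟩
      (a - b) + (b′ - a′)      ≈⟨ interchange _ _ _ _ ⟩
      (a + b′) + (- b - a′)    ≈⟨ +-cong a+b′≈a′+b (⁻¹-∙-comm _ _) ⟩
      (a′ + b) - (b + a′)      ≈⟨ +-congˡ (-‿cong (+-comm _ _)) ⟩
      (a′ + b) - (a′ + b)      ≈⟨ -‿inverseʳ _ ⟩
      0#                       ∎)

    ⟦⟧ᴰ-cong : ∀ m n m′ n′ → m ℕ.+ n′ ≡ m′ ℕ.+ n → ⟦ m , n ⟧ᴰ ≈ ⟦ m′ , n′ ⟧ᴰ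
    ⟦⟧ᴰ-cong m n m′ n′ m+n′≡m′+n = begin
      ⟦ m , n ⟧ᴰ             ≈⟨ ⟦⟧ᴰ≈ m n ⟩
      m ×ᵣ 1# - n ×ᵣ 1#      ≈⟨ difference-cong _ _ _ _ (begin
        m ×ᵣ 1# + n′ ×ᵣ 1#     ≈⟨ ×-homo-+ 1# m n′ ⟨
        (m ℕ.+ n′) ×ᵣ 1#       ≡⟨ ≡.cong (_×ᵣ 1#) m+n′≡m′+n ⟩
        (m′ ℕ.+ n) ×ᵣ 1#       ≈⟨ ×-homo-+ 1# m′ n ⟩
        m′ ×ᵣ 1# + n ×ᵣ 1#     ∎) ⟩
      m′ ×ᵣ 1# - n′ ×ᵣ 1#    ≈⟨ ⟦⟧ᴰ≈ m′ n′ ⟨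
      ⟦ m′ , n′ ⟧ᴰ           ∎

    ⟦canonical⟧ : ∀ m n → ⟦ canonical (m , n) ⟧ᴰ ≈ ⟦ m , n ⟧ᴰ
    ⟦canonical⟧ zero    n       = refl
    ⟦canonical⟧ (suc m) zero    = refl
    ⟦canonical⟧ (suc m) (suc n) = trans (⟦canonical⟧ m n) (⟦⟧ᴰ-cong m n (suc m) (suc n) (ℕ.+-suc m n))

    homomorphism : Differences -Raw-AlmostCommutative⟶ fromCommutativeRing R
    homomorphism = record
      { ⟦_⟧    = ⟦_⟧ᴰ
      ; +-homo = λ (m , n) (m′ , n′) → begin
          ⟦ canonical (m ℕ.+ m′ , n ℕ.+ n′) ⟧ᴰ              ≈⟨ ⟦canonical⟧ (m ℕ.+ m′) (n ℕ.+ n′) ⟩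
          ⟦ m ℕ.+ m′ , n ℕ.+ n′ ⟧ᴰ                          ≈⟨ ⟦⟧ᴰ≈ (m ℕ.+ m′) (n ℕ.+ n′) ⟩
          (m ℕ.+ m′) ×ᵣ 1# - (n ℕ.+ n′) ×ᵣ 1#              ≈⟨ +-cong (×-homo-+ 1# m m′) (-‿cong (×-homo-+ 1# n n′)) ⟩
          (m ×ᵣ 1# + m′ ×ᵣ 1#) - (n ×ᵣ 1# + n′ ×ᵣ 1#)       ≈⟨ +-congˡ (⁻¹-∙-comm _ _) ⟨
          (m ×ᵣ 1# + m′ ×ᵣ 1#) + (- (n ×ᵣ 1#) - n′ ×ᵣ 1#)   ≈⟨ interchange _ _ _ _ ⟩
          (m ×ᵣ 1# - n ×ᵣ 1#) + (m′ ×ᵣ 1# - n′ ×ᵣ 1#)       ≈⟨ +-cong (⟦⟧ᴰ≈ m n) (⟦⟧ᴰ≈ m′ n′) ⟨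
          ⟦ m , n ⟧ᴰ + ⟦ m′ , n′ ⟧ᴰ                          ∎
      ; *-homo = λ (m , n) (m′ , n′) → begin
          ⟦ canonical (m ℕ.* m′ ℕ.+ n ℕ.* n′ , m ℕ.* n′ ℕ.+ n ℕ.* m′) ⟧ᴰ
            ≈⟨ ⟦canonical⟧ (m ℕ.* m′ ℕ.+ n ℕ.* n′) (m ℕ.* n′ ℕ.+ n ℕ.* m′) ⟩
          ⟦ m ℕ.* m′ ℕ.+ n ℕ.* n′ , m ℕ.* n′ ℕ.+ n ℕ.* m′ ⟧ᴰ
            ≈⟨ ⟦⟧ᴰ≈ (m ℕ.* m′ ℕ.+ n ℕ.* n′) (m ℕ.* n′ ℕ.+ n ℕ.* m′) ⟩
          (m ℕ.* m′ ℕ.+ n ℕ.* n′) ×ᵣ 1# - (m ℕ.* n′ ℕ.+ n ℕ.* m′) ×ᵣ 1#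
            ≈⟨ +-cong (trans (×-homo-+ 1# (m ℕ.* m′) (n ℕ.* n′)) (+-cong (×1-homo-* m m′) (×1-homo-* n n′)))
                      (-‿cong (trans (×-homo-+ 1# (m ℕ.* n′) (n ℕ.* m′)) (+-cong (×1-homo-* m n′) (×1-homo-* n m′)))) ⟩
          (m ×ᵣ 1# * (m′ ×ᵣ 1#) + n ×ᵣ 1# * (n′ ×ᵣ 1#)) - (m ×ᵣ 1# * (n′ ×ᵣ 1#) + n ×ᵣ 1# * (m′ ×ᵣ 1#))
            ≈⟨ difference-product _ _ _ _ ⟩
          (m ×ᵣ 1# - n ×ᵣ 1#) * (m′ ×ᵣ 1# - n′ ×ᵣ 1#)
            ≈⟨ *-cong (⟦⟧ᴰ≈ m n) (⟦⟧ᴰ≈ m′ n′) ⟨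
          ⟦ m , n ⟧ᴰ * ⟦ m′ , n′ ⟧ᴰ                          ∎
      ; -‿homo = λ (m , n) → trans (⟦⟧ᴰ≈ n m) (trans (sym (⁻¹-anti-homo‿- _ _)) (-‿cong (sym (⟦⟧ᴰ≈ m n))))
      ; 0-homo = refl
      ; 1-homo = refl
      }

    coefficients≟ : ∀ x y → Maybe (⟦ x ⟧ᴰ ≈ ⟦ y ⟧ᴰ)
    coefficients≟ (m , n) (m′ , n′) with m ℕ.+ n′ ℕ.≟ m′ ℕ.+ n
    ... | no _            = nothing
    ... | yes m+n′≡m′+n   = just (⟦⟧ᴰ-cong m n m′ n′ m+n′≡m′+n)

  open import Algebra.Solver.Ring Differences (fromCommutativeRing R) homomorphism coefficients≟ public

  :0 :1 : ∀ {k} → Polynomial k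
  :0 = con (0 , 0)
  :1 = con (1 , 0)

module Farey where
  open import Data.Nat using (_+_; _*_)
  open import Data.Nat.Coprimality using (Coprime; coprime-Bézout)
  open import Data.Nat.Divisibility using (_∣_; ∣1⇒≡1; ∣m+n∣m⇒∣n; n∣m*n; ∣m⇒∣m*n; ∣n⇒∣m*n; ∣-refl)
  open import Data.Nat.GCD using (module Bézout)
  open import Data.Nat.Induction using (<-wellFounded)
  open import Data.Nat.Tactic.RingSolver using (solve)
  open import Data.List using ([]; _∷_)
  open import Induction.WellFounded using (Acc; acc)
  open import Relation.Binary.Definitions using (tri<; tri≈; tri>)
  open ≡ using (refl; sym; trans; cong; subst)

  Neighbours : ℕ → ℕ → ℕ → ℕ → Set
  Neighbours r s r′ s′ = r′ * s ≡ 1 + r * s′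

  variable r s r′ s′ : ℕ

  data SternBrocot : ℕ → ℕ → ℕ → ℕ → Set where
    root  : SternBrocot 0 1 1 1
    left  : SternBrocot r s r′ s′ → SternBrocot r s (r + r′) (s + s′)
    right : SternBrocot r s r′ s′ → SternBrocot (r + r′) (s + s′) r′ s′

  ∣1+m∣m⇒≡1 : ∀ {d m} → d ∣ 1 + m → d ∣ m → d ≡ 1
  ∣1+m∣m⇒≡1 {d} {m} d∣1+m d∣m = ∣1⇒≡1 (∣m+n∣m⇒∣n (subst (d ∣_) (ℕ.+-comm 1 m) d∣1+m) d∣m)

  neighbours⇒coprimeˡ : Neighbours r s r′ s′ → Coprime r s
  neighbours⇒coprimeˡ {r} {s} {r′} {s′} r/s⋈r′/s′ {d} (d∣r , d∣s) =
    ∣1+m∣m⇒≡1 (subst (d ∣_) r/s⋈r′/s′ (∣n⇒∣m*n r′ d∣s)) (∣m⇒∣m*n s′ d∣r)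

  neighbours⇒coprimeʳ : Neighbours r s r′ s′ → Coprime r′ s′
  neighbours⇒coprimeʳ {r} {s} {r′} {s′} r/s⋈r′/s′ {d} (d∣r′ , d∣s′) =
    ∣1+m∣m⇒≡1 (subst (d ∣_) r/s⋈r′/s′ (∣m⇒∣m*n s d∣r′)) (∣n⇒∣m*n r d∣s′)

  neighbours⇒< : Neighbours r s r′ s′ → r′ ℕ.≤ s′ → r ℕ.< s
  neighbours⇒< {r} {s} {r′} {s′} r/s⋈r′/s′ r′≤s′ = ℕ.*-cancelʳ-< s′ r s (begin-strict
    r * s′        <⟨ ℕ.n<1+n (r * s′) ⟩
    1 + r * s′    ≡⟨ r/s⋈r′/s′ ⟨
    r′ * s        ≤⟨ ℕ.*-monoˡ-≤ s r′≤s′ ⟩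
    s′ * s        ≡⟨ ℕ.*-comm s′ s ⟩
    s * s′        ∎)
    where open ℕ.≤-Reasoning

  neighbours⇒0<s′ : Neighbours r s r′ s′ → r′ ℕ.≤ s′ → 0 ℕ.< s′
  neighbours⇒0<s′ {s′ = suc _} _ _ = s≤s z≤n
  neighbours⇒0<s′ {r′ = zero} {s′ = zero} () _

  neighbours⇒<ʳ : Neighbours r s r′ s′ → s ℕ.≤ s′ → r ℕ.< r′
  neighbours⇒<ʳ {r} {s} {r′} {s′} r/s⋈r′/s′ s≤s′ = ℕ.*-cancelʳ-< s r r′ (begin-strict
    r * s         ≤⟨ ℕ.*-monoʳ-≤ r s≤s′ ⟩
    r * s′        <⟨ ℕ.n<1+n _ ⟩
    1 + r * s′    ≡⟨ r/s⋈r′/s′ ⟨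
    r′ * s        ∎)
    where open ℕ.≤-Reasoning

  neighbours⇒≤ˡ : Neighbours r s r′ s′ → r′ ℕ.≤ s′ → s′ ℕ.< s → r′ ℕ.≤ r
  neighbours⇒≤ˡ {r} {s} {r′} {s′} r/s⋈r′/s′ r′≤s′ s′<s = ℕ.≤-pred (ℕ.*-cancelʳ-< s r′ (suc r) (begin-strict
    r′ * s        ≡⟨ r/s⋈r′/s′ ⟩
    1 + r * s′    <⟨ ℕ.+-mono-<-≤ 1<s (ℕ.*-monoʳ-≤ r (ℕ.<⇒≤ s′<s)) ⟩
    s + r * s     ∎))
    where
    open ℕ.≤-Reasoning
    1<s : 1 ℕ.< s
    1<s = ℕ.≤-trans (s≤s (neighbours⇒0<s′ {r} {s} r/s⋈r′/s′ r′≤s′)) s′<s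

  neighbours⇒≤ʳ : Neighbours r s r′ s′ → r ℕ.< s → 0 ℕ.< s′ → r′ ℕ.≤ s′
  neighbours⇒≤ʳ {r} {s} {r′} {s′} r/s⋈r′/s′ r<s 0<s′ = ℕ.*-cancelʳ-≤ r′ s′ s (begin
    r′ * s         ≡⟨ r/s⋈r′/s′ ⟩
    1 + r * s′     ≤⟨ ℕ.+-monoˡ-≤ (r * s′) 0<s′ ⟩
    s′ + r * s′    ≤⟨ ℕ.*-monoˡ-≤ s′ r<s ⟩
    s * s′         ≡⟨ ℕ.*-comm s s′ ⟩
    s′ * s         ∎)
    where
    open ℕ.≤-Reasoning
    instance _ = ℕ.>-nonZero (ℕ.m<n⇒0<n r<s)

  sb-neighbours : SternBrocot r s r′ s′ → Neighbours r s r′ s′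
  sb-neighbours root = refl
  sb-neighbours (left {r} {s} {r′} {s′} p) = begin
    (r + r′) * s           ≡⟨ ℕ.*-distribʳ-+ s r r′ ⟩
    r * s + r′ * s         ≡⟨ cong (λ x → r * s + x) (sb-neighbours p) ⟩
    r * s + (1 + r * s′)   ≡⟨ solve (r ∷ s ∷ s′ ∷ []) ⟩
    1 + r * (s + s′)       ∎
    where open ≡.≡-Reasoning
  sb-neighbours (right {r} {s} {r′} {s′} p) = begin
    r′ * (s + s′)          ≡⟨ ℕ.*-distribˡ-+ r′ s s′ ⟩
    r′ * s + r′ * s′       ≡⟨ cong (λ x → x + r′ * s′) (sb-neighbours p) ⟩
    1 + r * s′ + r′ * s′   ≡⟨ solve (r ∷ r′ ∷ s′ ∷ []) ⟩
    1 + (r + r′) * s′      ∎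
    where open ≡.≡-Reasoning

  sb-≤ : SternBrocot r s r′ s′ → r′ ℕ.≤ s′
  sb-≤ root      = s≤s z≤n
  sb-≤ (left p)  = ℕ.+-mono-≤ (ℕ.<⇒≤ (neighbours⇒< (sb-neighbours p) (sb-≤ p))) (sb-≤ p)
  sb-≤ (right p) = sb-≤ p

  private
    <⇒∃[o]m+o≡n : ∀ {m n} → m ℕ.< n → ∃ λ o → 0 ℕ.< o × m + o ≡ n
    <⇒∃[o]m+o≡n {m} m<n with ℕ.m≤n⇒∃[o]m+o≡n m<n
    ... | o , 1+m+o≡n = suc o , s≤s z≤n , trans (ℕ.+-suc m o) 1+m+o≡n

    <⇒∃[o]o+m≡n : ∀ {m n} → m ℕ.< n → ∃ λ o → 0 ℕ.< o × o + m ≡ n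
    <⇒∃[o]o+m≡n {m} m<n with <⇒∃[o]m+o≡n m<n
    ... | o , 0<o , m+o≡n = o , 0<o , trans (ℕ.+-comm o m) m+o≡n

    ≤⇒∃[o]o+m≡n : ∀ {m n} → m ℕ.≤ n → ∃ λ o → o + m ≡ n
    ≤⇒∃[o]o+m≡n {m} m≤n with ℕ.m≤n⇒∃[o]m+o≡n m≤n
    ... | o , m+o≡n = o , trans (ℕ.+-comm o m) m+o≡n

  right-parent : ∀ {e f} → Neighbours r s (r + e) (s + f) → r + e ℕ.≤ s + f → 0 ℕ.< f →
                 Neighbours r s e f × e ℕ.≤ f
  right-parent {r} {s} {e} {f} r/s⋈r′/s′ r′≤s′ 0<f = r/s⋈e/f , neighbours⇒≤ʳ {r} {s} r/s⋈e/f r<s 0<f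
    where
    r<s : r ℕ.< s
    r<s = neighbours⇒< {r} {s} r/s⋈r′/s′ r′≤s′
    r/s⋈e/f : Neighbours r s e f
    r/s⋈e/f = ℕ.+-cancelˡ-≡ (r * s) _ _ (begin
      r * s + e * s         ≡⟨ ℕ.*-distribʳ-+ s r e ⟨
      (r + e) * s           ≡⟨ r/s⋈r′/s′ ⟩
      1 + r * (s + f)       ≡⟨ solve (r ∷ s ∷ f ∷ []) ⟩
      r * s + (1 + r * f)   ∎)
      where open ≡.≡-Reasoning

  left-parent : ∀ {e f} → Neighbours (e + r′) (f + s′) r′ s′ → Neighbours e f r′ s′
  left-parent {r′} {s′} {e} {f} r/s⋈r′/s′ = ℕ.+-cancelˡ-≡ (r′ * s′) _ _ (begin
    r′ * s′ + r′ * f         ≡⟨ solve (r′ ∷ s′ ∷ f ∷ []) ⟩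
    r′ * (f + s′)            ≡⟨ r/s⋈r′/s′ ⟩
    1 + (e + r′) * s′        ≡⟨ solve (e ∷ r′ ∷ s′ ∷ []) ⟩
    r′ * s′ + (1 + e * s′)   ∎)
    where open ≡.≡-Reasoning

  neighbours⇒s≡1 : Neighbours r s r′ s → s ≡ 1
  neighbours⇒s≡1 {r} {s} {r′} r/s⋈r′/s = ∣1+m∣m⇒≡1 (subst (s ∣_) r/s⋈r′/s (n∣m*n r′)) (n∣m*n r)

  sb-complete-root : Neighbours r 1 r′ 1 → r′ ℕ.≤ 1 → SternBrocot r 1 r′ 1
  sb-complete-root {zero}  {suc zero}     _ _ = root
  sb-complete-root {suc r} {suc zero}     ()
  sb-complete-root {r}     {zero}         ()
  sb-complete-root {r}     {suc (suc r′)} _ (s≤s ())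

  -- The endpoint with the larger denominator is the mediant of the other endpoint and a
  -- fraction of smaller denominator; the two denominators are equal only for (0/1, 1/1).
  sb-complete′ : Acc ℕ._<_ (s + s′) → r′ ℕ.≤ s′ → Neighbours r s r′ s′ → SternBrocot r s r′ s′
  sb-complete′ {s} {s′} {r′} {r} (acc smaller) r′≤s′ r/s⋈r′/s′ with ℕ.<-cmp s s′
  ... | tri≈ _ refl _ with neighbours⇒s≡1 {r} {s} {r′} r/s⋈r′/s′
  ...   | refl = sb-complete-root r/s⋈r′/s′ r′≤s′
  sb-complete′ {s} {s′} {r′} {r} (acc smaller) r′≤s′ r/s⋈r′/s′ | tri< s<s′ _ _
    with <⇒∃[o]m+o≡n s<s′
  ... | f , 0<f , refl with ℕ.m≤n⇒∃[o]m+o≡n (ℕ.<⇒≤ (neighbours⇒<ʳ {r} {s} {r′} r/s⋈r′/s′ (ℕ.m≤m+n s f)))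
  ...   | e , refl with right-parent {r} {s} r/s⋈r′/s′ r′≤s′ 0<f
  ...     | r/s⋈e/f , e≤f = left (sb-complete′ (smaller s+f<s+s′) e≤f r/s⋈e/f)
    where
    s+f<s+s′ : s + f ℕ.< s + (s + f)
    s+f<s+s′ = ℕ.+-monoʳ-< s (ℕ.m<n+m f (ℕ.m<n⇒0<n (neighbours⇒< {r} {s} r/s⋈e/f e≤f)))
  sb-complete′ {s} {s′} {r′} {r} (acc smaller) r′≤s′ r/s⋈r′/s′ | tri> _ _ s′<s
    with <⇒∃[o]o+m≡n s′<s
  ... | f , 0<f , refl with ≤⇒∃[o]o+m≡n (neighbours⇒≤ˡ {r} {s} {r′} r/s⋈r′/s′ r′≤s′ s′<s)
  ...   | e , refl = right (sb-complete′ (smaller f+s′<s+s′) r′≤s′ (left-parent {r′} {s′} {e} {f} r/s⋈r′/s′))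
    where
    f+s′<s+s′ : f + s′ ℕ.< (f + s′) + s′
    f+s′<s+s′ = ℕ.m<m+n (f + s′) (neighbours⇒0<s′ {e + r′} {f + s′} r/s⋈r′/s′ r′≤s′)

  sb-complete : r′ ℕ.≤ s′ → Neighbours r s r′ s′ → SternBrocot r s r′ s′
  sb-complete = sb-complete′ (<-wellFounded _)

  sb-endpoint : Coprime r s → r ℕ.≤ s →
                (∃₂ λ r′ s′ → SternBrocot r s r′ s′) ⊎ (∃₂ λ r′ s′ → SternBrocot r′ s′ r s)
  sb-endpoint {r} {s} coprime r≤s with ℕ.m≤n⇒m<n∨m≡n r≤s
  ... | inj₂ refl with coprime (∣-refl , ∣-refl)
  ...   | refl = inj₂ (0 , 1 , root)
  sb-endpoint {r} {s} coprime r≤s | inj₁ r<s with coprime-Bézout coprime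
  ... | Bézout.+- x y 1+ys≡xr = inj₂ (y , x , sb-complete r≤s (trans (ℕ.*-comm r x) (sym 1+ys≡xr)))
  -- x = 0 only for r/s = 0/1, whose Bézout partner y/x = 1/0 lies outside [0, 1].
  ... | Bézout.-+ zero y 1≡ys with ∣1⇒≡1 (subst (s ∣_) (sym 1≡ys) (n∣m*n y)) | r<s
  ...   | refl | s≤s z≤n = inj₁ (1 , 1 , root)
  sb-endpoint {r} {s} coprime r≤s | inj₁ r<s | Bézout.-+ (suc x) y 1+xr≡ys =
    inj₁ (y , suc x , sb-complete (neighbours⇒≤ʳ {r} {s} r/s⋈y/x r<s (s≤s z≤n)) r/s⋈y/x)
    where
    r/s⋈y/x : Neighbours r s y (suc x)
    r/s⋈y/x = trans (sym 1+xr≡ys) (cong suc (ℕ.*-comm (suc x) r))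

module Fractions where
  open import Data.Nat.Coprimality using (Coprime; recompute)
  open import Data.Integer using (+≤+)
  open Farey
  open ≡ using (refl; sym; trans; cong; cong₂; subst; subst₂)

  infix 4 _≐_/_
  record _≐_/_ (a : ℚ) (r s : ℕ) : Set where
    constructor _,_
    field
      ↥≡ : ↥ a ≡ + r
      ↧≡ : ↧ a ≡ + s

  variable a b t : ℚ

  ≐-unique : a ≐ r / s → b ≐ r / s → a ≡ b
  ≐-unique {a = mkℚ _ _ _} {b = mkℚ _ _ _} (refl , refl) (refl , refl) = refl

  coprime⇒fraction : Coprime r s → 0 ℕ.< s → ∃ λ a → a ≐ r / s
  coprime⇒fraction {r} {suc d} coprime _ = mkℚ (+ r) d coprime , refl , refl

  sb-lower : SternBrocot r s r′ s′ → ∃ λ a → a ≐ r / s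
  sb-lower {r} {s} {r′} {s′} p = coprime⇒fraction (neighbours⇒coprimeˡ {r} {s} {r′} {s′} (sb-neighbours p))
                                         (ℕ.m<n⇒0<n (neighbours⇒< {r} {s} (sb-neighbours p) (sb-≤ p)))

  sb-upper : SternBrocot r s r′ s′ → ∃ λ b → b ≐ r′ / s′
  sb-upper {r} {s} p = coprime⇒fraction (neighbours⇒coprimeʳ {r} {s} (sb-neighbours p))
                                (neighbours⇒0<s′ {r} {s} (sb-neighbours p) (sb-≤ p))

  ≐⇒0≤ : a ≐ r / s → 0ℚ ≤ a
  ≐⇒0≤ {a} (↥a≡r , _) = *≤* (subst (+ 0 ℤ.≤_) (sym (trans (ℤ.*-identityʳ (↥ a)) ↥a≡r)) (+≤+ z≤n))

  ≐⇒≤1 : a ≐ r / s → r ℕ.≤ s → a ≤ 1ℚ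
  ≐⇒≤1 {a} (↥a≡r , ↧a≡s) r≤s =
    *≤* (subst₂ ℤ._≤_ (sym (trans (ℤ.*-identityʳ (↥ a)) ↥a≡r)) (sym (trans (ℤ.*-identityˡ (↧ a)) ↧a≡s)) (+≤+ r≤s))

  ≐⇒det : a ≐ r / s → b ≐ r′ / s′ → Neighbours r s r′ s′ → ↥ b ℤ.* ↧ a ℤ.- ↥ a ℤ.* ↧ b ≡ + 1
  ≐⇒det {a = mkℚ _ _ _} {r} {s} {b = mkℚ _ _ _} {r′} {s′} (refl , refl) (refl , refl) r/s⋈r′/s′ = begin
    + r′ ℤ.* + s ℤ.- + r ℤ.* + s′       ≡⟨ cong₂ ℤ._-_ (ℤ.pos-* r′ s) (ℤ.pos-* r s′) ⟨
    + (r′ ℕ.* s) ℤ.- + (r ℕ.* s′)       ≡⟨ cong (λ m → + m ℤ.- + (r ℕ.* s′)) r/s⋈r′/s′ ⟩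
    + 1 ℤ.+ + (r ℕ.* s′) ℤ.- + (r ℕ.* s′) ≡⟨ 1+x-x≡1 (+ (r ℕ.* s′)) ⟩
    + 1                                 ∎
    where
    open ≡.≡-Reasoning
    1+x-x≡1 : ∀ x → + 1 ℤ.+ x ℤ.- x ≡ + 1
    1+x-x≡1 = solve-∀

  ≐-mediant : a ≐ r / s → b ≐ r′ / s′ → t ≐ r ℕ.+ r′ / s ℕ.+ s′ → ↥ t ≡ ↥ a ℤ.+ ↥ b × ↧ t ≡ ↧ a ℤ.+ ↧ b
  ≐-mediant (↥a≡r , ↧a≡s) (↥b≡r′ , ↧b≡s′) (↥t≡r+r′ , ↧t≡s+s′) =
    trans ↥t≡r+r′ (sym (cong₂ ℤ._+_ ↥a≡r ↥b≡r′)) , trans ↧t≡s+s′ (sym (cong₂ ℤ._+_ ↧a≡s ↧b≡s′))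

  unit-interval⇒fraction : ∀ t → 0ℚ ≤ t → t ≤ 1ℚ → ∃₂ λ r s → t ≐ r / s × Coprime r s × r ℕ.≤ s
  unit-interval⇒fraction (mkℚ -[1+ _ ] _ _) (*≤* ())
  unit-interval⇒fraction (mkℚ (+ r) d coprime) _ (*≤* r*1≤1*s) =
    r , suc d , (refl , refl) , recompute coprime ,
    ℤ.drop‿+≤+ (subst₂ ℤ._≤_ (ℤ.*-identityʳ (+ r)) (ℤ.*-identityˡ (+ suc d)) r*1≤1*s)

module QMatrices {c ℓ} (R : CommutativeRing c ℓ) (q q⁻ : CommutativeRing.Carrier R) where
  open CommutativeRing R
  open QDefs R q q⁻
  open M2
  open RingSolver R
  open import Relation.Binary.Reasoning.Setoid setoid

  ≈M-refl : ∀ {X} → X ≈M X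
  ≈M-refl = refl , refl , refl , refl

  ·-cong : ∀ {X X′ Y Y′} → X ≈M X′ → Y ≈M Y′ → (X · Y) ≈M (X′ · Y′)
  ·-cong (e₁₁ , e₁₂ , e₂₁ , e₂₂) (f₁₁ , f₁₂ , f₂₁ , f₂₂) =
    +-cong (*-cong e₁₁ f₁₁) (*-cong e₁₂ f₂₁) , +-cong (*-cong e₁₁ f₁₂) (*-cong e₁₂ f₂₂) ,
    +-cong (*-cong e₂₁ f₁₁) (*-cong e₂₂ f₂₁) , +-cong (*-cong e₂₁ f₁₂) (*-cong e₂₂ f₂₂)

  det : M2 R → Carrier
  det X = m11 X * m22 X - m12 X * m21 X

  ψ : M2 R → Carrier
  ψ X = m11 X + q * q * (q * m22 X) - q * qint (+ 3) * m12 X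

  ψ-cong : ∀ {X Y} → X ≈M Y → ψ X ≈ ψ Y
  ψ-cong (e₁₁ , e₁₂ , _ , e₂₂) = +-cong (+-cong e₁₁ (*-congˡ (*-congˡ e₂₂))) (-‿cong (*-congˡ e₁₂))

  -- Syntactic counterparts of _·_, tr, det, pow, qint and ψ for the solver; each unfolds to
  -- exactly the term it mirrors.
  record M2ᴾ (k : ℕ) : Set where
    constructor matᴾ
    field p11 p12 p21 p22 : Polynomial k
  open M2ᴾ

  module _ {k : ℕ} where
    _·ᴾ_ : M2ᴾ k → M2ᴾ k → M2ᴾ k
    X ·ᴾ Y = matᴾ (p11 X :* p11 Y :+ p12 X :* p21 Y) (p11 X :* p12 Y :+ p12 X :* p22 Y)
                  (p21 X :* p11 Y :+ p22 X :* p21 Y) (p21 X :* p12 Y :+ p22 X :* p22 Y)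

    trᴾ detᴾ : M2ᴾ k → Polynomial k
    trᴾ X  = p11 X :+ p22 X
    detᴾ X = p11 X :* p22 X :- p12 X :* p21 X

    powᴾ qintᴾ : ℕ → Polynomial k → Polynomial k
    powᴾ zero    x = :1
    powᴾ (suc j) x = x :* powᴾ j x
    qintᴾ zero    x = :0
    qintᴾ (suc j) x = :1 :+ x :* qintᴾ j x

    ψᴾ : Polynomial k → M2ᴾ k → Polynomial k
    ψᴾ x X = p11 X :+ x :* x :* (x :* p22 X) :- x :* qintᴾ 3 x :* p12 X

  ψ-cayley-hamiltonˡ : ∀ X Y → ψ (X · (X · Y)) ≈ tr X * ψ (X · Y) - det X * ψ Y
  ψ-cayley-hamiltonˡ X Y =
    solve 9 (λ x x₁₁ x₁₂ x₂₁ x₂₂ y₁₁ y₁₂ y₂₁ y₂₂ →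
               let Xᴾ = matᴾ x₁₁ x₁₂ x₂₁ x₂₂; Yᴾ = matᴾ y₁₁ y₁₂ y₂₁ y₂₂ in
               ψᴾ x (Xᴾ ·ᴾ (Xᴾ ·ᴾ Yᴾ)) := trᴾ Xᴾ :* ψᴾ x (Xᴾ ·ᴾ Yᴾ) :- detᴾ Xᴾ :* ψᴾ x Yᴾ)
            refl q (m11 X) (m12 X) (m21 X) (m22 X) (m11 Y) (m12 Y) (m21 Y) (m22 Y)

  ψ-cayley-hamiltonʳ : ∀ X Y → ψ ((X · Y) · Y) ≈ tr Y * ψ (X · Y) - det Y * ψ X
  ψ-cayley-hamiltonʳ X Y =
    solve 9 (λ x x₁₁ x₁₂ x₂₁ x₂₂ y₁₁ y₁₂ y₂₁ y₂₂ →
               let Xᴾ = matᴾ x₁₁ x₁₂ x₂₁ x₂₂; Yᴾ = matᴾ y₁₁ y₁₂ y₂₁ y₂₂ in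
               ψᴾ x ((Xᴾ ·ᴾ Yᴾ) ·ᴾ Yᴾ) := trᴾ Yᴾ :* ψᴾ x (Xᴾ ·ᴾ Yᴾ) :- detᴾ Yᴾ :* ψᴾ x Xᴾ)
            refl q (m11 X) (m12 X) (m21 X) (m22 X) (m11 Y) (m12 Y) (m21 Y) (m22 Y)

  private
    t*0-d*0≈0 : ∀ t d → t * 0# - d * 0# ≈ 0#
    t*0-d*0≈0 = solve 2 (λ t d → t :* :0 :- d :* :0 := :0) refl

  ψ-closedˡ : ∀ {X Y} → ψ (X · Y) ≈ 0# → ψ Y ≈ 0# → ψ (X · (X · Y)) ≈ 0#
  ψ-closedˡ {X} {Y} ψXY≈0 ψY≈0 = begin
    ψ (X · (X · Y))                ≈⟨ ψ-cayley-hamiltonˡ X Y ⟩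
    tr X * ψ (X · Y) - det X * ψ Y ≈⟨ +-cong (*-congˡ ψXY≈0) (-‿cong (*-congˡ ψY≈0)) ⟩
    tr X * 0# - det X * 0#         ≈⟨ t*0-d*0≈0 (tr X) (det X) ⟩
    0#                             ∎

  ψ-closedʳ : ∀ {X Y} → ψ (X · Y) ≈ 0# → ψ X ≈ 0# → ψ ((X · Y) · Y) ≈ 0#
  ψ-closedʳ {X} {Y} ψXY≈0 ψX≈0 = begin
    ψ ((X · Y) · Y)                ≈⟨ ψ-cayley-hamiltonʳ X Y ⟩
    tr Y * ψ (X · Y) - det Y * ψ X ≈⟨ +-cong (*-congˡ ψXY≈0) (-‿cong (*-congˡ ψX≈0)) ⟩
    tr Y * 0# - det Y * 0#         ≈⟨ t*0-d*0≈0 (tr Y) (det Y) ⟩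
    0#                             ∎

  -- With x₁₂ = q y₁₂, the products x₂₁ y₁₂ and x₁₂ y₂₁ are expressed through the determinants,
  -- so ψ (X · Y) only depends on the entries x₁₁, y₁₁, y₁₂, q x₂₂ and q y₂₂.
  ψ-· : ∀ {X Y a b c u v} → det X ≈ 1# → det Y ≈ 1# → m12 X ≈ q * m12 Y →
        m11 X ≈ a → m11 Y ≈ b → m12 Y ≈ c → q * m22 X ≈ u → q * m22 Y ≈ v →
        ψ (X · Y) ≈ a * b + b * v + q * a * u + q * u * v - q * qint (+ 3) * c * (a + v) - (q + q * q)
  ψ-· {X} {Y} {a} {b} {c} {u} {v} detX≈1 detY≈1 x₁₂≈qy₁₂ x₁₁≈a y₁₁≈b y₁₂≈c qx₂₂≈u qy₂₂≈v = begin
    ψ (X · Y)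
      ≈⟨ ψ-cong (·-cong (refl , x₁₂≈qy₁₂ , refl , refl) ≈M-refl) ⟩
    ψ (X′ · Y)
      ≈⟨ solve 8 (λ x x₁₁ x₂₁ x₂₂ y₁₁ y₁₂ y₂₁ y₂₂ →
                    let Xᴾ = matᴾ x₁₁ (x :* y₁₂) x₂₁ x₂₂; Yᴾ = matᴾ y₁₁ y₁₂ y₂₁ y₂₂ in
                    ψᴾ x (Xᴾ ·ᴾ Yᴾ)
                      := x₁₁ :* y₁₁ :+ y₁₁ :* (x :* y₂₂) :+ x :* x₁₁ :* (x :* x₂₂) :+ x :* (x :* x₂₂) :* (x :* y₂₂)
                           :- x :* qintᴾ 3 x :* y₁₂ :* (x₁₁ :+ x :* y₂₂) :- (x :* detᴾ Yᴾ :+ x :* x :* detᴾ Xᴾ))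
                 refl q (m11 X) (m21 X) (m22 X) (m11 Y) (m12 Y) (m21 Y) (m22 Y) ⟩
    m11 X * m11 Y + m11 Y * (q * m22 Y) + q * m11 X * (q * m22 X) + q * (q * m22 X) * (q * m22 Y)
      - q * qint (+ 3) * m12 Y * (m11 X + q * m22 Y) - (q * det Y + q * q * det X′)
      ≈⟨ +-cong (+-cong (+-cong (+-cong (+-cong (*-cong x₁₁≈a y₁₁≈b) (*-cong y₁₁≈b qy₂₂≈v))
                                        (*-cong (*-congˡ x₁₁≈a) qx₂₂≈u))
                                (*-cong (*-congˡ qx₂₂≈u) qy₂₂≈v))
                        (-‿cong (*-cong (*-congˡ y₁₂≈c) (+-cong x₁₁≈a qy₂₂≈v))))
                (-‿cong (+-cong (trans (*-congˡ detY≈1) (*-identityʳ q))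
                                (trans (*-congˡ (trans detX′≈detX detX≈1)) (*-identityʳ (q * q))))) ⟩
    a * b + b * v + q * a * u + q * u * v - q * qint (+ 3) * c * (a + v) - (q + q * q) ∎
    where
    X′ : M2 R
    X′ = mat (m11 X) (q * m12 Y) (m21 X) (m22 X)
    detX′≈detX : det X′ ≈ det X
    detX′≈detX = +-congˡ (-‿cong (*-congʳ (sym x₁₂≈qy₁₂)))

  module QIntegers (q*q⁻≈1 : q * q⁻ ≈ 1#) where
    open import Algebra.Properties.Group +-group using (∙-cancelˡ)
    open import Algebra.Properties.Ring ring using (-‿distribʳ-*)
    open import Algebra.Properties.CommutativeSemigroup *-commutativeSemigroup using (x∙yz≈y∙xz)

    q*[q⁻*x]≈x : ∀ x → q * (q⁻ * x) ≈ x
    q*[q⁻*x]≈x x = trans (sym (*-assoc q q⁻ x)) (trans (*-congʳ q*q⁻≈1) (*-identityˡ x))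

    q⁻*[q*x]≈x : ∀ x → q⁻ * (q * x) ≈ x
    q⁻*[q*x]≈x x = trans (x∙yz≈y∙xz q⁻ q x) (q*[q⁻*x]≈x x)

    q*-cancelˡ : ∀ {x y} → q * x ≈ q * y → x ≈ y
    q*-cancelˡ {x} {y} qx≈qy = trans (sym (q⁻*[q*x]≈x x)) (trans (*-congˡ qx≈qy) (q⁻*[q*x]≈x y))

    qpow-suc : ∀ i → qpow (ℤ.suc i) ≈ q * qpow i
    qpow-suc (+ k)        = refl
    qpow-suc -[1+ zero  ] = sym (q*[q⁻*x]≈x 1#)
    qpow-suc -[1+ suc k ] = sym (q*[q⁻*x]≈x (pow q⁻ (suc k)))

    qint-suc : ∀ i → qint (ℤ.suc i) ≈ 1# + q * qint i
    qint-suc (+ k)        = refl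
    qint-suc -[1+ zero  ] = sym (begin
      1# + q * - (q⁻ * (1# + 0#))   ≈⟨ +-congˡ (-‿distribʳ-* q _) ⟨
      1# - q * (q⁻ * (1# + 0#))     ≈⟨ +-congˡ (-‿cong (q*[q⁻*x]≈x _)) ⟩
      1# - (1# + 0#)                ≈⟨ solve 0 (:1 :- (:1 :+ :0) := :0) refl ⟩
      0#                            ∎)
    qint-suc -[1+ suc k ] = sym (begin
      1# + q * - (q⁻ * (1# + g))    ≈⟨ +-congˡ (-‿distribʳ-* q _) ⟨
      1# - q * (q⁻ * (1# + g))      ≈⟨ +-congˡ (-‿cong (q*[q⁻*x]≈x _)) ⟩
      1# - (1# + g)                 ≈⟨ solve 1 (λ g → :1 :- (:1 :+ g) := :- g) refl g ⟩
      - g                           ∎)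
      where g = negGeom (suc k)

    affine-unique : ∀ α (f g : ℤ → Carrier) →
                    (∀ i → f (ℤ.suc i) ≈ α + q * f i) → (∀ i → g (ℤ.suc i) ≈ α + q * g i) →
                    f (+ 0) ≈ g (+ 0) → ∀ i → f i ≈ g i
    affine-unique α f g f-step g-step f0≈g0 = go
      where
      down : ∀ {i} → f (ℤ.suc i) ≈ g (ℤ.suc i) → f i ≈ g i
      down {i} fsi≈gsi = q*-cancelˡ (∙-cancelˡ α _ _ (trans (sym (f-step i)) (trans fsi≈gsi (g-step i))))

      go : ∀ i → f i ≈ g i
      go (+ zero)       = f0≈g0
      go (+ suc k)      = trans (f-step (+ k)) (trans (+-congˡ (*-congˡ (go (+ k)))) (sym (g-step (+ k))))
      go -[1+ zero  ]   = down f0≈g0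
      go -[1+ suc k ]   = down (go -[1+ k ])

    qpow-+ : ∀ i j → qpow (i ℤ.+ j) ≈ qpow i * qpow j
    qpow-+ i j = affine-unique 0# (λ i → qpow (i ℤ.+ j)) (λ i → qpow i * qpow j) lhs-step rhs-step
                   (trans (reflexive (≡.cong qpow (ℤ.+-identityˡ j))) (sym (*-identityˡ _))) i
      where
      lhs-step : ∀ i → qpow (ℤ.suc i ℤ.+ j) ≈ 0# + q * qpow (i ℤ.+ j)
      lhs-step i = begin
        qpow (ℤ.suc i ℤ.+ j)     ≡⟨ ≡.cong qpow (ℤ.+-assoc (+ 1) i j) ⟩
        qpow (ℤ.suc (i ℤ.+ j))   ≈⟨ qpow-suc (i ℤ.+ j) ⟩
        q * qpow (i ℤ.+ j)       ≈⟨ +-identityˡ _ ⟨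
        0# + q * qpow (i ℤ.+ j)  ∎
      rhs-step : ∀ i → qpow (ℤ.suc i) * qpow j ≈ 0# + q * (qpow i * qpow j)
      rhs-step i = begin
        qpow (ℤ.suc i) * qpow j        ≈⟨ *-congʳ (qpow-suc i) ⟩
        q * qpow i * qpow j            ≈⟨ solve 3 (λ x a b → x :* a :* b := :0 :+ x :* (a :* b)) refl q (qpow i) (qpow j) ⟩
        0# + q * (qpow i * qpow j)     ∎

    qint-+ : ∀ i j → qint (i ℤ.+ j) ≈ qint i + qpow i * qint j
    qint-+ i j = affine-unique 1# (λ i → qint (i ℤ.+ j)) (λ i → qint i + qpow i * qint j) lhs-step rhs-step
                   (trans (reflexive (≡.cong qint (ℤ.+-identityˡ j))) (solve 1 (λ b → b := :0 :+ :1 :* b) refl (qint j))) i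
      where
      lhs-step : ∀ i → qint (ℤ.suc i ℤ.+ j) ≈ 1# + q * qint (i ℤ.+ j)
      lhs-step i = trans (reflexive (≡.cong qint (ℤ.+-assoc (+ 1) i j))) (qint-suc (i ℤ.+ j))
      rhs-step : ∀ i → qint (ℤ.suc i) + qpow (ℤ.suc i) * qint j ≈ 1# + q * (qint i + qpow i * qint j)
      rhs-step i = begin
        qint (ℤ.suc i) + qpow (ℤ.suc i) * qint j   ≈⟨ +-cong (qint-suc i) (*-congʳ (qpow-suc i)) ⟩
        1# + q * qint i + q * qpow i * qint j      ≈⟨ solve 4 (λ x a p b → :1 :+ x :* a :+ x :* p :* b := :1 :+ x :* (a :+ p :* b))
                                                            refl q (qint i) (qpow i) (qint j) ⟩
        1# + q * (qint i + qpow i * qint j)        ∎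

    qpow≈1+[q-1]qint : ∀ i → qpow i ≈ 1# + (q - 1#) * qint i
    qpow≈1+[q-1]qint = affine-unique 0# qpow (λ i → 1# + (q - 1#) * qint i)
      (λ i → trans (qpow-suc i) (sym (+-identityˡ _)))
      (λ i → begin
        1# + (q - 1#) * qint (ℤ.suc i)      ≈⟨ +-congˡ (*-congˡ (qint-suc i)) ⟩
        1# + (q - 1#) * (1# + q * qint i)   ≈⟨ solve 2 (λ x a → :1 :+ (x :- :1) :* (:1 :+ x :* a)
                                                           := :0 :+ x :* (:1 :+ (x :- :1) :* a)) refl q (qint i) ⟩
        0# + q * (1# + (q - 1#) * qint i)   ∎)
      (solve 1 (λ x → :1 := :1 :+ (x :- :1) :* :0) refl q)

  module TraceFormulas (q*q⁻≈1 : q * q⁻ ≈ 1#) where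
    open QIntegers q*q⁻≈1 using (q*-cancelˡ)

    private
      q*q⁻*x≈x : ∀ x → q * q⁻ * x ≈ x
      q*q⁻*x≈x x = trans (*-congʳ q*q⁻≈1) (*-identityˡ x)

    ψ≈0⇒trace≈₁ : ∀ {X} → ψ X ≈ 0# → tr X ≈ (q⁻ * qint (+ 3)) * ((q⁻ - q⁻ * q⁻) * m11 X + q⁻ * m12 X)
    ψ≈0⇒trace≈₁ {X} ψX≈0 = q*-cancelˡ (q*-cancelˡ (q*-cancelˡ (begin
      q * (q * (q * tr X))
        ≈⟨ solve 4 (λ x a b d → x :* (x :* (x :* (a :+ d)))
                     := qintᴾ 3 x :* ((x :- :1) :* a :+ x :* b) :+ (a :+ x :* x :* (x :* d) :- x :* qintᴾ 3 x :* b))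
                   refl q (m11 X) (m12 X) (m22 X) ⟩
      qint (+ 3) * ((q - 1#) * m11 X + q * m12 X) + ψ X     ≈⟨ +-congˡ ψX≈0 ⟩
      qint (+ 3) * ((q - 1#) * m11 X + q * m12 X) + 0#      ≈⟨ +-identityʳ _ ⟩
      qint (+ 3) * ((q - 1#) * m11 X + q * m12 X)           ≈⟨ *-congˡ (+-congʳ (*-congʳ (+-congˡ (-‿cong q*q⁻≈1)))) ⟨
      qint (+ 3) * ((q - q * q⁻) * m11 X + q * m12 X)       ≈⟨ trans (q*q⁻*x≈x _) (q*q⁻*x≈x _) ⟨
      q * q⁻ * (q * q⁻ * (qint (+ 3) * ((q - q * q⁻) * m11 X + q * m12 X)))
        ≈⟨ solve 4 (λ x s a b → x :* s :* (x :* s :* (qintᴾ 3 x :* ((x :- x :* s) :* a :+ x :* b)))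
                     := x :* (x :* (x :* (s :* qintᴾ 3 x :* ((s :- s :* s) :* a :+ s :* b)))))
                   refl q q⁻ (m11 X) (m12 X) ⟩
      q * (q * (q * ((q⁻ * qint (+ 3)) * ((q⁻ - q⁻ * q⁻) * m11 X + q⁻ * m12 X)))) ∎)))

    ψ≈0⇒trace≈₂ : ∀ {X} → ψ X ≈ 0# → tr X ≈ (q⁻ * qint (+ 3)) * (q * q * m12 X + q * (1# - q) * m22 X)
    ψ≈0⇒trace≈₂ {X} ψX≈0 = begin
      tr X
        ≈⟨ solve 4 (λ x a b d → a :+ d
                     := qintᴾ 3 x :* (x :* b :+ (:1 :- x) :* d) :+ (a :+ x :* x :* (x :* d) :- x :* qintᴾ 3 x :* b))
                   refl q (m11 X) (m12 X) (m22 X) ⟩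
      qint (+ 3) * (q * m12 X + (1# - q) * m22 X) + ψ X     ≈⟨ +-congˡ ψX≈0 ⟩
      qint (+ 3) * (q * m12 X + (1# - q) * m22 X) + 0#      ≈⟨ +-identityʳ _ ⟩
      qint (+ 3) * (q * m12 X + (1# - q) * m22 X)           ≈⟨ q*q⁻*x≈x _ ⟨
      q * q⁻ * (qint (+ 3) * (q * m12 X + (1# - q) * m22 X))
        ≈⟨ solve 4 (λ x s b d → x :* s :* (qintᴾ 3 x :* (x :* b :+ (:1 :- x) :* d))
                     := (s :* qintᴾ 3 x) :* (x :* x :* b :+ x :* (:1 :- x) :* d))
                   refl q q⁻ (m12 X) (m22 X) ⟩
      (q⁻ * qint (+ 3)) * (q * q * m12 X + q * (1# - q) * m22 X) ∎

  module InitialMatrices (q*q⁻≈1 : q * q⁻ ≈ 1#) where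
    open QIntegers q*q⁻≈1

    private
      2-m≡1+[1-m] : ∀ m → + 2 ℤ.- m ≡ + 1 ℤ.+ (+ 1 ℤ.- m)
      2-m≡1+[1-m] = solve-∀
      3-m≡2+[1-m] : ∀ m → + 3 ℤ.- m ≡ + 2 ℤ.+ (+ 1 ℤ.- m)
      3-m≡2+[1-m] = solve-∀
      [1-m]+m≡1 : ∀ m → (+ 1 ℤ.- m) ℤ.+ m ≡ + 1
      [1-m]+m≡1 = solve-∀
      [1-m]+[m-1]≡0 : ∀ m → (+ 1 ℤ.- m) ℤ.+ (m ℤ.- + 1) ≡ + 0
      [1-m]+[m-1]≡0 = solve-∀
      1-m≡1+[1-[m+1]] : ∀ m → + 1 ℤ.- m ≡ + 1 ℤ.+ (+ 1 ℤ.- (m ℤ.+ + 1))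
      1-m≡1+[1-[m+1]] = solve-∀

    A-m11 : ∀ m → m11 (A m) ≈ q * (1# - qint (+ 1 ℤ.- m))
    A-m11 m = begin
      qpow (+ 2 ℤ.- m) * qint m                  ≡⟨ ≡.cong (λ i → qpow i * qint m) (2-m≡1+[1-m] m) ⟩
      qpow (ℤ.suc (+ 1 ℤ.- m)) * qint m          ≈⟨ *-congʳ (qpow-suc (+ 1 ℤ.- m)) ⟩
      q * qpow (+ 1 ℤ.- m) * qint m              ≈⟨ *-assoc q _ _ ⟩
      q * (qpow (+ 1 ℤ.- m) * qint m)            ≈⟨ *-congˡ (solve 2 (λ z y → y := z :+ y :- z) refl z _) ⟩
      q * (z + qpow (+ 1 ℤ.- m) * qint m - z)    ≈⟨ *-congˡ (+-congʳ (qint-+ (+ 1 ℤ.- m) m)) ⟨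
      q * (qint ((+ 1 ℤ.- m) ℤ.+ m) - z)         ≡⟨ ≡.cong (λ i → q * (qint i - z)) ([1-m]+m≡1 m) ⟩
      q * (1# + q * 0# - z)                      ≈⟨ solve 2 (λ x z → x :* (:1 :+ x :* :0 :- z) := x :* (:1 :- z)) refl q z ⟩
      q * (1# - z)                               ∎
      where z = qint (+ 1 ℤ.- m)

    A-m12 : ∀ m → m12 (A m) ≈ 1# + (q - 1#) * qint (+ 1 ℤ.- m)
    A-m12 m = qpow≈1+[q-1]qint (+ 1 ℤ.- m)

    A-m22 : ∀ m → q * m22 (A m) ≈ qint (+ 2) + qpow (+ 2) * qint (+ 1 ℤ.- m)
    A-m22 m = begin
      q * (q⁻ * qint (+ 3 ℤ.- m))                  ≈⟨ q*[q⁻*x]≈x _ ⟩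
      qint (+ 3 ℤ.- m)                             ≡⟨ ≡.cong qint (3-m≡2+[1-m] m) ⟩
      qint (+ 2 ℤ.+ (+ 1 ℤ.- m))                   ≈⟨ qint-+ (+ 2) (+ 1 ℤ.- m) ⟩
      qint (+ 2) + qpow (+ 2) * qint (+ 1 ℤ.- m)   ∎

    A-det : ∀ m → det (A m) ≈ 1#
    A-det m = begin
      qpow (+ 2 ℤ.- m) * g * (q⁻ * X) - P * (g * X - P′)
        ≈⟨ solve 6 (λ s P₂ g X P P′ → P₂ :* g :* (s :* X) :- P :* (g :* X :- P′) := s :* P₂ :* (g :* X) :- P :* (g :* X :- P′))
                   refl q⁻ (qpow (+ 2 ℤ.- m)) g X P P′ ⟩
      q⁻ * qpow (+ 2 ℤ.- m) * (g * X) - P * (g * X - P′)   ≈⟨ +-congʳ (*-congʳ q⁻*qpow[2-m]≈P) ⟩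
      P * (g * X) - P * (g * X - P′)                       ≈⟨ solve 3 (λ P y P′ → P :* y :- P :* (y :- P′) := P :* P′) refl P (g * X) P′ ⟩
      P * P′                                               ≈⟨ qpow-+ (+ 1 ℤ.- m) (m ℤ.- + 1) ⟨
      qpow ((+ 1 ℤ.- m) ℤ.+ (m ℤ.- + 1))                   ≡⟨ ≡.cong qpow ([1-m]+[m-1]≡0 m) ⟩
      1#                                                   ∎
      where
      g = qint m
      X = qint (+ 3 ℤ.- m)
      P = qpow (+ 1 ℤ.- m)
      P′ = qpow (m ℤ.- + 1)
      q⁻*qpow[2-m]≈P : q⁻ * qpow (+ 2 ℤ.- m) ≈ P
      q⁻*qpow[2-m]≈P = begin
        q⁻ * qpow (+ 2 ℤ.- m)          ≡⟨ ≡.cong (λ i → q⁻ * qpow i) (2-m≡1+[1-m] m) ⟩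
        q⁻ * qpow (ℤ.suc (+ 1 ℤ.- m))  ≈⟨ *-congˡ (qpow-suc (+ 1 ℤ.- m)) ⟩
        q⁻ * (q * P)                   ≈⟨ q⁻*[q*x]≈x P ⟩
        P                              ∎

    A-m12-shift : ∀ m → m12 (A m) ≈ q * m12 (A (m ℤ.+ + 1))
    A-m12-shift m = trans (reflexive (≡.cong qpow (1-m≡1+[1-[m+1]] m))) (qpow-suc (+ 1 ℤ.- (m ℤ.+ + 1)))

    qint[1-m]-shift : ∀ m → qint (+ 1 ℤ.- m) ≈ 1# + q * qint (+ 1 ℤ.- (m ℤ.+ + 1))
    qint[1-m]-shift m = trans (reflexive (≡.cong qint (1-m≡1+[1-[m+1]] m))) (qint-suc (+ 1 ℤ.- (m ℤ.+ + 1)))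

    ψ-A : ∀ m → ψ (A m) ≈ 0#
    ψ-A m = begin
      ψ (A m)
        ≈⟨ +-cong (+-cong (A-m11 m) (*-congˡ (A-m22 m))) (-‿cong (*-congˡ (A-m12 m))) ⟩
      q * (1# - z) + q * q * (qint (+ 2) + qpow (+ 2) * z) - q * qint (+ 3) * (1# + (q - 1#) * z)
        ≈⟨ solve 2 (λ x z → x :* (:1 :- z) :+ x :* x :* (qintᴾ 2 x :+ powᴾ 2 x :* z)
                              :- x :* qintᴾ 3 x :* (:1 :+ (x :- :1) :* z) := :0) refl q z ⟩
      0# ∎
      where z = qint (+ 1 ℤ.- m)

    ψ-B : ∀ n → ψ (B n) ≈ 0#
    ψ-B n = begin
      ψ (A n · A (n ℤ.+ + 1))
        ≈⟨ ψ-· (A-det n) (A-det (n ℤ.+ + 1)) (A-m12-shift n) x₁₁≈ (A-m11 (n ℤ.+ + 1)) (A-m12 (n ℤ.+ + 1))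
               qx₂₂≈ (A-m22 (n ℤ.+ + 1)) ⟩
      x₁₁ * y₁₁ + y₁₁ * v + q * x₁₁ * u + q * u * v - q * qint (+ 3) * y₁₂ * (x₁₁ + v) - (q + q * q)
        ≈⟨ solve 2 (λ x w →
             let x₁₁ = x :* (:1 :- (:1 :+ x :* w))
                 y₁₁ = x :* (:1 :- w)
                 y₁₂ = :1 :+ (x :- :1) :* w
                 u   = qintᴾ 2 x :+ powᴾ 2 x :* (:1 :+ x :* w)
                 v   = qintᴾ 2 x :+ powᴾ 2 x :* w
             in x₁₁ :* y₁₁ :+ y₁₁ :* v :+ x :* x₁₁ :* u :+ x :* u :* v
                  :- x :* qintᴾ 3 x :* y₁₂ :* (x₁₁ :+ v) :- (x :+ x :* x) := :0) refl q w ⟩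
      0# ∎
      where
      w   = qint (+ 1 ℤ.- (n ℤ.+ + 1))
      x₁₁ = q * (1# - (1# + q * w))
      y₁₁ = q * (1# - w)
      y₁₂ = 1# + (q - 1#) * w
      u   = qint (+ 2) + qpow (+ 2) * (1# + q * w)
      v   = qint (+ 2) + qpow (+ 2) * w
      x₁₁≈ : m11 (A n) ≈ x₁₁
      x₁₁≈ = trans (A-m11 n) (*-congˡ (+-congˡ (-‿cong (qint[1-m]-shift n))))
      qx₂₂≈ : q * m22 (A n) ≈ u
      qx₂₂≈ = trans (A-m22 n) (+-congˡ (*-congˡ (qint[1-m]-shift n)))

  module Invariance (q*q⁻≈1 : q * q⁻ ≈ 1#) (n : ℤ) (C : ℚ → M2 R) (C-0 : C 0ℚ ≈M A n) (C-1 : C 1ℚ ≈M B n)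
                    (C-mediant : ∀ (a b t : ℚ) → 0ℚ ≤ a → b ≤ 1ℚ →
                                 (↥ b) ℤ.* (↧ a) ℤ.- (↥ a) ℤ.* (↧ b) ≡ + 1 →
                                 ↥ t ≡ (↥ a) ℤ.+ (↥ b) → ↧ t ≡ (↧ a) ℤ.+ (↧ b) →
                                 C t ≈M (C a · C b)) where
    open InitialMatrices q*q⁻≈1
    open Farey
    open Fractions

    Invariant : ℚ → ℚ → Set ℓ
    Invariant a b = ψ (C a) ≈ 0# × ψ (C b) ≈ 0# × ψ (C a · C b) ≈ 0#

    C-sb-mediant : SternBrocot r s r′ s′ → a ≐ r / s → b ≐ r′ / s′ → t ≐ r ℕ.+ r′ / s ℕ.+ s′ →
                   C t ≈M (C a · C b)
    C-sb-mediant p a≐r/s b≐r′/s′ t≐mediant =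
      let ↥t≡↥a+↥b , ↧t≡↧a+↧b = ≐-mediant a≐r/s b≐r′/s′ t≐mediant in
      C-mediant _ _ _ (≐⇒0≤ a≐r/s) (≐⇒≤1 b≐r′/s′ (sb-≤ p)) (≐⇒det a≐r/s b≐r′/s′ (sb-neighbours p))
                ↥t≡↥a+↥b ↧t≡↧a+↧b

    sb-invariant : SternBrocot r s r′ s′ → a ≐ r / s → b ≐ r′ / s′ → Invariant a b
    sb-invariant root a≐0/1 b≐1/1
      with ≐-unique {b = 0ℚ} a≐0/1 (≡.refl , ≡.refl) | ≐-unique {b = 1ℚ} b≐1/1 (≡.refl , ≡.refl)
    ... | ≡.refl | ≡.refl =
      trans (ψ-cong C-0) (ψ-A n) ,
      trans (ψ-cong C-1) (ψ-B n) ,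
      trans (ψ-cong (·-cong C-0 C-1)) (ψ-closedˡ (ψ-B n) (ψ-A (n ℤ.+ + 1)))
    sb-invariant {a = a} {b = t} (left p) a≐r/s t≐mediant with sb-upper p
    ... | b , b≐r′/s′ with sb-invariant p a≐r/s b≐r′/s′
    ...   | ψCa≈0 , ψCb≈0 , ψCaCb≈0 =
      ψCa≈0 ,
      trans (ψ-cong Ct≈CaCb) ψCaCb≈0 ,
      trans (ψ-cong (·-cong ≈M-refl Ct≈CaCb)) (ψ-closedˡ ψCaCb≈0 ψCb≈0)
      where
      Ct≈CaCb : C t ≈M (C a · C b)
      Ct≈CaCb = C-sb-mediant p a≐r/s b≐r′/s′ t≐mediant
    sb-invariant {a = t} {b = b} (right p) t≐mediant b≐r′/s′ with sb-lower p
    ... | a , a≐r/s with sb-invariant p a≐r/s b≐r′/s′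
    ...   | ψCa≈0 , ψCb≈0 , ψCaCb≈0 =
      trans (ψ-cong Ct≈CaCb) ψCaCb≈0 ,
      ψCb≈0 ,
      trans (ψ-cong (·-cong Ct≈CaCb ≈M-refl)) (ψ-closedʳ ψCaCb≈0 ψCa≈0)
      where
      Ct≈CaCb : C t ≈M (C a · C b)
      Ct≈CaCb = C-sb-mediant p a≐r/s b≐r′/s′ t≐mediant

    ψ-C≈0 : ∀ t → 0ℚ ≤ t → t ≤ 1ℚ → ψ (C t) ≈ 0#
    ψ-C≈0 t 0≤t t≤1 with unit-interval⇒fraction t 0≤t t≤1
    ... | r , s , t≐r/s , coprime , r≤s with sb-endpoint coprime r≤s
    ...   | inj₁ (_ , _ , p) = proj₁ (sb-invariant p t≐r/s (proj₂ (sb-upper p)))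
    ...   | inj₂ (_ , _ , p) = proj₁ (proj₂ (sb-invariant p (proj₂ (sb-lower p)) t≐r/s))

lemma4p5 : ∀ {c ℓ} (R : CommutativeRing c ℓ) (q q⁻ : CommutativeRing.Carrier R) →
  let open CommutativeRing R
      open QDefs R q q⁻
      open M2
  in q * q⁻ ≈ 1# →
     (n : ℤ) (C : ℚ → M2 R) →
     C 0ℚ ≈M A n →
     C 1ℚ ≈M B n →
     (∀ (a b t : ℚ) → 0ℚ ≤ a → b ≤ 1ℚ →
        (↥ b) ℤ.* (↧ a) ℤ.- (↥ a) ℤ.* (↧ b) ≡ + 1 →
        ↥ t ≡ (↥ a) ℤ.+ (↥ b) → ↧ t ≡ (↧ a) ℤ.+ (↧ b) →
        C t ≈M (C a · C b)) →
     ∀ (t : ℚ) → 0ℚ ≤ t → t ≤ 1ℚ →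
       (tr (C t) ≈ (q⁻ * qint (+ 3)) * ((q⁻ - q⁻ * q⁻) * m11 (C t) + q⁻ * m12 (C t)))
       × (tr (C t) ≈ (q⁻ * qint (+ 3)) * (q * q * m12 (C t) + q * (1# - q) * m22 (C t)))
lemma4p5 R q q⁻ q*q⁻≈1 n C C-0 C-1 C-mediant t 0≤t t≤1 = ψ≈0⇒trace≈₁ {C t} ψCt≈0 , ψ≈0⇒trace≈₂ {C t} ψCt≈0
  where
  open CommutativeRing R
  open QMatrices R q q⁻
  open TraceFormulas q*q⁻≈1
  ψCt≈0 : ψ (C t) ≈ 0#
  ψCt≈0 = Invariance.ψ-C≈0 q*q⁻≈1 n C C-0 C-1 C-mediant t 0≤t t≤1
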